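{- Let $\mathcal{F}$ be a 2-generic $\mathbb{Q}_1$-filter, let $\Phi_e(G, n, m)$ be a $\Delta_0$ formula with free variables $n, m$, and let $p \in \mathcal{F}$. (a) If $p \Vdash (\exists n)(\forall m)\Phi_e(G, n, m)$, then $(\exists n)(\forall m)\Phi_e(G_\mathcal{F}, n, m)$ holds. (b) If $p \Vdash (\forall n)(\exists m)\neg \Phi_e(G, n, m)$, then $(\forall n)(\exists m)\neg \Phi_e(G_\mathcal{F}, n, m)$ holds.
   Context: A binary string $\sigma$ is identified with the finite set $F_\sigma = \{x < |\sigma| : \sigma(x) = 1\}$; for strings, $\sigma \cup \rho$, $\tau - \sigma$ refer to these finite sets, $\rho \subseteq X$ means $F_\rho \subseteq X$, and $\sigma \preceq \tau$ is the prefix relation; $\Phi_e(\sigma, n, m)$ means the formula evaluated with $G = F_\sigma$. Fix an effective enumeration $\mathcal{U}_0, \mathcal{U}_1, \dots$ of all $\Sigma^0_1$ classes in $2^\omega$ upward closed under $\supseteq$. A largeness class is a class $\mathcal{A} \subseteq 2^\omega$ upward closed under $\supseteq$ such that for every $k$-cover $Y_0 \cup \dots \cup Y_{k-1} \supseteq \omega$ some $Y_j \in \mathcal{A}$. Let $\zeta$ be the computable function with $\mathcal{U}_{\zeta(e,\sigma,n)} = \{X : (\exists \rho \subseteq X - \{0,\dots,|\sigma|\})(\exists m)\neg\Phi_e(\sigma \cup \rho, n, m)\}$ for every index $e$ of a $\Delta_0$ formula, string $\sigma$ and $n$. $\mathbb{Q}_1$ is the set of tuples $(\sigma, X, C, U)$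 ($\sigma$ a binary string, $X, C, U \subseteq \omega$) with $X \cap \{0, \dots, |\sigma|\} = \emptyset$, $U \subseteq X$, $\bigcap_{e \in C}\mathcal{U}_e$ a largeness class containing only infinite sets, and $U \in \bigcap_{e \in C}\mathcal{U}_e$; ordered by $(\tau, Y, D, V) \leq (\sigma, X, C, U)$ iff $\sigma \preceq \tau$, $Y \subseteq X$, $V \subseteq U$, $C \subseteq D$, $\tau - \sigma \subseteq U$. For $p = (\sigma, X, C, U)$: $p \Vdash (\exists n)(\forall m)\Phi_e(G,n,m)$ iff there is $n$ with $\Phi_e(\sigma \cup \tau, n, m)$ for every string $\tau \subseteq X$ and every $m$; $p \Vdash (\forall n)(\exists m)\neg\Phi_e(G,n,m)$ iff $\zeta(e, \sigma \cup \rho, n) \in C$ for every string $\rho \subseteq U$ and every $n$. A $\mathbb{Q}_1$-filter is a nonempty $\mathcal{F} \subseteq \mathbb{Q}_1$ upward closed under $\leq$ in which any two elements have a common lower bound in $\mathcal{F}$; it is 2-generic if for every $\Delta_0$ formula $\Phi_e(G,n,m)$ some $p \in \mathcal{F}$ satisfies $p \Vdash (\exists n)(\forall m)\Phi_e(G,n,m)$ or $p \Vdash (\forall n)(\exists m)\neg\Phi_e(G,n,m)$. For $\mathcal{F} \subseteq \mathbb{Q}_1$, $G_\mathcal{F} = \bigcup\{F_\sigma : (\sigma, X, C, U) \in \mathcal{F}\}$. -}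

module Defs where

open import Level using (0ℓ)
open import Data.Nat using (ℕ; zero; suc; _+_; _*_; _<_; _≤_)
open import Data.Fin using (Fin)
open import Data.Bool using (Bool; true; false; _∨_)
open import Data.List using (List; []; _∷_; length)
open import Data.Vec using (Vec; []; _∷_; lookup)
open import Data.Product using (Σ; _×_; _,_; ∃)
open import Data.Empty using (⊥)
open import Data.Sum using (_⊎_)
open import Relation.Nullary using (¬_)
open import Relation.Binary.PropositionalEquality using (_≡_)

Subset : Set
Subset = ℕ → Bool

_∈ˢ_ : ℕ → Subset → Set
x ∈ˢ X = X x ≡ true

Class : Set₁
Class = Subset → Set

_⊆ˢ_ : Subset → Subset → Set
X ⊆ˢ Y = ∀ x → x ∈ˢ X → x ∈ˢ Y

UpwardClosed : Class → Set
UpwardClosed 𝒜 = ∀ X Y → X ⊆ˢ Y → 𝒜 X → 𝒜 Y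

IsLargeness : Class → Set
IsLargeness 𝒜 =
  UpwardClosed 𝒜 ×
  ((k : ℕ) (Y : Fin k → Subset) → (∀ x → ∃ λ j → x ∈ˢ Y j) → ∃ λ j → 𝒜 (Y j))

Infinite : Subset → Set
Infinite X = ∀ n → ∃ λ x → n < x × x ∈ˢ X

ContainsOnlyInfinite : Class → Set
ContainsOnlyInfinite 𝒜 = ∀ X → 𝒜 X → Infinite X

Str : Set
Str = List Bool

-- characteristic function of F_σ = {x < |σ| : σ(x) = 1}
fs : Str → Subset
fs []            _       = false
fs (b ∷ σ)       zero    = b
fs (b ∷ σ)       (suc x) = fs σ x

-- σ ∪ ρ as a string (pointwise or, padding the shorter one with 0s);
-- its finite set is F_σ ∪ F_ρ.
_∪ˢᵗʳ_ : Str → Str → Str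
[]      ∪ˢᵗʳ ρ       = ρ
(b ∷ σ) ∪ˢᵗʳ []      = b ∷ σ
(b ∷ σ) ∪ˢᵗʳ (c ∷ ρ) = (b ∨ c) ∷ (σ ∪ˢᵗʳ ρ)

_⊑_ : Str → Subset → Set
ρ ⊑ X = fs ρ ⊆ˢ X

data _≼_ : Str → Str → Set where
  []≼  : ∀ {τ} → [] ≼ τ
  ∷≼   : ∀ {b σ τ} → σ ≼ τ → (b ∷ σ) ≼ (b ∷ τ)

DiffSub : Str → Str → Subset → Set
DiffSub τ σ U = ∀ x → x ∈ˢ fs τ → ¬ (x ∈ˢ fs σ) → x ∈ˢ U

-- Δ₀ formulas of first-order arithmetic with a set parameter G,
-- with k free number variables (de Bruijn, Fin k).

data Term (k : ℕ) : Set where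
  var   : Fin k → Term k
  zeroᵗ : Term k
  sucᵗ  : Term k → Term k
  _+ᵗ_  : Term k → Term k → Term k
  _*ᵗ_  : Term k → Term k → Term k

data Δ₀ (k : ℕ) : Set where
  _≐_   : Term k → Term k → Δ₀ k
  _≺_   : Term k → Term k → Δ₀ k
  _∈G   : Term k → Δ₀ k
  ¬ᶠ_   : Δ₀ k → Δ₀ k
  _∧ᶠ_  : Δ₀ k → Δ₀ k → Δ₀ k
  _∨ᶠ_  : Δ₀ k → Δ₀ k → Δ₀ k
  _⇒ᶠ_  : Δ₀ k → Δ₀ k → Δ₀ k
  -- (∀ x < t) φ  and  (∃ x < t) φ ; the bound variable is var zero in φ
  ∀<    : Term k → Δ₀ (suc k) → Δ₀ k
  ∃<    : Term k → Δ₀ (suc k) → Δ₀ k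

⟦_⟧ᵗ : ∀ {k} → Term k → Vec ℕ k → ℕ
⟦ var i ⟧ᵗ   ρ = lookup ρ i
⟦ zeroᵗ ⟧ᵗ   ρ = zero
⟦ sucᵗ t ⟧ᵗ  ρ = suc (⟦ t ⟧ᵗ ρ)
⟦ t +ᵗ s ⟧ᵗ  ρ = ⟦ t ⟧ᵗ ρ + ⟦ s ⟧ᵗ ρ
⟦ t *ᵗ s ⟧ᵗ  ρ = ⟦ t ⟧ᵗ ρ * ⟦ s ⟧ᵗ ρ

Sat : ∀ {k} → (ℕ → Set) → Δ₀ k → Vec ℕ k → Set
Sat G (t ≐ s)   ρ = ⟦ t ⟧ᵗ ρ ≡ ⟦ s ⟧ᵗ ρ
Sat G (t ≺ s)   ρ = ⟦ t ⟧ᵗ ρ < ⟦ s ⟧ᵗ ρ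
Sat G (t ∈G)    ρ = G (⟦ t ⟧ᵗ ρ)
Sat G (¬ᶠ φ)    ρ = ¬ Sat G φ ρ
Sat G (φ ∧ᶠ ψ)  ρ = Sat G φ ρ × Sat G ψ ρ
Sat G (φ ∨ᶠ ψ)  ρ = Sat G φ ρ ⊎ Sat G ψ ρ
Sat G (φ ⇒ᶠ ψ)  ρ = Sat G φ ρ → Sat G ψ ρ
Sat G (∀< t φ)  ρ = ∀ x → x < ⟦ t ⟧ᵗ ρ → Sat G φ (x ∷ ρ)
Sat G (∃< t φ)  ρ = ∃ λ x → x < ⟦ t ⟧ᵗ ρ × Sat G φ (x ∷ ρ)

-- Φ(G, n, m) for a formula with the two free variables n (var 0), m (var 1)
Φ⟨_,_,_⟩ : Δ₀ 2 → (ℕ → Set) → ℕ → ℕ → Set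
Φ⟨ φ , G , n ⟩ m = Sat G φ (n ∷ m ∷ [])

Φˢ : Δ₀ 2 → Str → ℕ → ℕ → Set
Φˢ φ σ n m = Φ⟨ φ , (λ x → x ∈ˢ fs σ) , n ⟩ m

IsUpwardEnumeration : (ℕ → Class) → Set
IsUpwardEnumeration 𝒰 = ∀ e → UpwardClosed (𝒰 e)

IsZeta : (ℕ → Class) → (Δ₀ 2 → Str → ℕ → ℕ) → Set
IsZeta 𝒰 ζ = ∀ φ σ n X →
  (𝒰 (ζ φ σ n) X →
     Σ Str λ ρ → (ρ ⊑ X) × (∀ x → x ∈ˢ fs ρ → length σ < x) ×
       ∃ λ m → ¬ Φˢ φ (σ ∪ˢᵗʳ ρ) n m)
  ×
  ((Σ Str λ ρ → (ρ ⊑ X) × (∀ x → x ∈ˢ fs ρ → length σ < x) ×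
       ∃ λ m → ¬ Φˢ φ (σ ∪ˢᵗʳ ρ) n m) → 𝒰 (ζ φ σ n) X)

record Cond : Set where
  constructor ⟨_,_,_,_⟩
  field
    str : Str
    X   : Subset
    C   : Subset
    U   : Subset
open Cond public

⋂𝒰 : (ℕ → Class) → Subset → Class
⋂𝒰 𝒰 C Y = ∀ e → e ∈ˢ C → 𝒰 e Y

InQ₁ : (ℕ → Class) → Cond → Set
InQ₁ 𝒰 p =
  (∀ x → x ≤ length (str p) → ¬ (x ∈ˢ X p)) ×
  (U p ⊆ˢ X p) ×
  IsLargeness (⋂𝒰 𝒰 (C p)) ×
  ContainsOnlyInfinite (⋂𝒰 𝒰 (C p)) ×
  ⋂𝒰 𝒰 (C p) (U p)

_≤Q_ : Cond → Cond → Set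
q ≤Q p =
  (str p ≼ str q) × (X q ⊆ˢ X p) × (U q ⊆ˢ U p) × (C p ⊆ˢ C q) ×
  DiffSub (str q) (str p) (U p)

Forces∃∀ : Cond → Δ₀ 2 → Set
Forces∃∀ p φ = ∃ λ n → ∀ τ → τ ⊑ X p → ∀ m → Φˢ φ (str p ∪ˢᵗʳ τ) n m

Forces∀∃ : (Δ₀ 2 → Str → ℕ → ℕ) → Cond → Δ₀ 2 → Set
Forces∀∃ ζ p φ = ∀ ρ → ρ ⊑ U p → ∀ n → ζ φ (str p ∪ˢᵗʳ ρ) n ∈ˢ C p

IsFilter : (ℕ → Class) → (Cond → Set) → Set
IsFilter 𝒰 ℱ =
  (∀ p → ℱ p → InQ₁ 𝒰 p) ×
  (∃ λ p → ℱ p) ×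
  (∀ p q → ℱ q → InQ₁ 𝒰 p → q ≤Q p → ℱ p) ×
  (∀ p q → ℱ p → ℱ q → ∃ λ r → ℱ r × r ≤Q p × r ≤Q q)

Is2Generic : (Δ₀ 2 → Str → ℕ → ℕ) → (Cond → Set) → Set
Is2Generic ζ ℱ = ∀ φ → ∃ λ p → ℱ p × (Forces∃∀ p φ ⊎ Forces∀∃ ζ p φ)

Gℱ : (Cond → Set) → ℕ → Set
Gℱ ℱ x = ∃ λ p → ℱ p × x ∈ˢ fs (str p)

-- Excluded middle and the directedness of ℱ give, for every B, a member of ℱ
-- below p whose string agrees with G_ℱ below B; since a Δ₀ formula only
-- queries G below a computable use bound, a Σ₂ fact forced by p, which holds
-- for every extension of p's string inside X p, transfers to G_ℱ.
-- For a forced Π₂ fact and fixed n, genericity decides (∃m)¬Φ(G, n, m) at some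
-- q ∈ ℱ, so it remains to refute q ⊩ (∀m)¬¬Φ(G, n, m).  A common extension r
-- of p and q has, by the forcing of p, an extension σ of its string inside U r
-- with ¬Φ(σ, n, m) for some m.  The forcing of q then puts into C q the index
-- of the class of sets containing an extension of σ that satisfies Φ(·, n, m).
-- That class contains {x ≥ B}, which lies in every largeness class of infinite
-- sets since {x < B} is finite; taking B to be the use bound of Φ(·, n, m), the
-- added elements are invisible to Φ, a contradiction.

module Submission where

open import Defs
open import Axiom.ExcludedMiddle using (ExcludedMiddle)
open import Data.Bool using (true; false)
open import Data.Bool.Properties using (∨-identityʳ; T-≡)
open import Data.Empty using (⊥; ⊥-elim)
open import Data.Fin using (Fin) renaming (zero to fzero; suc to fsuc)
open import Data.List using ([]; _∷_; length)
open import Data.Nat using (ℕ; zero; suc; _+_; _*_; _<_; _≤_; _⊔_; _≤ᵇ_; _<ᵇ_; z≤n; s≤s; _≤?_)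
open import Data.Nat.Properties
  using (≤-refl; ≤-trans; ≤-pred; <-asym; <⇒≱; ≰⇒>; ≤ᵇ⇒≤; ≤⇒≤ᵇ; <ᵇ⇒<; <⇒<ᵇ;
         m≤m⊔n; m≤n⊔m; m⊔n≤o⇒m≤o; m⊔n≤o⇒n≤o; m<1+n⇒m<n∨m≡n)
open import Data.Product using (Σ; _×_; _,_; ∃; proj₁; proj₂)
open import Data.Product.Function.NonDependent.Propositional using (_×-⇔_)
open import Data.Sum using (_⊎_; inj₁; inj₂)
open import Data.Sum.Function.Propositional using (_⊎-⇔_)
open import Data.Vec using (Vec; []; _∷_; lookup)
open import Function.Bundles using (_⇔_; mk⇔; Equivalence)
open import Function.Properties.Equivalence using () renaming (refl to ⇔-refl)
open import Function.Related.TypeIsomorphisms using (→-cong-⇔; ¬-cong-⇔)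
open import Relation.Nullary using (¬_; yes; no)
open import Relation.Binary.PropositionalEquality using (_≡_; refl; cong; cong₂; subst; sym; trans)

open Equivalence using (to; from)

F : Str → ℕ → Set
F σ x = x ∈ˢ fs σ

∈-∪ˢᵗʳ⁻ : ∀ σ ρ {x} → F (σ ∪ˢᵗʳ ρ) x → F σ x ⊎ F ρ x
∈-∪ˢᵗʳ⁻ []          ρ                 x∈ = inj₂ x∈
∈-∪ˢᵗʳ⁻ (b ∷ σ)     []                x∈ = inj₁ x∈
∈-∪ˢᵗʳ⁻ (true ∷ σ)  (c ∷ ρ) {zero}    _  = inj₁ refl
∈-∪ˢᵗʳ⁻ (false ∷ σ) (c ∷ ρ) {zero}    x∈ = inj₂ x∈
∈-∪ˢᵗʳ⁻ (b ∷ σ)     (c ∷ ρ) {suc x}   x∈ = ∈-∪ˢᵗʳ⁻ σ ρ x∈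

∈-∪ˢᵗʳ⁺ˡ : ∀ σ ρ {x} → F σ x → F (σ ∪ˢᵗʳ ρ) x
∈-∪ˢᵗʳ⁺ˡ (b ∷ σ)    []               x∈ = x∈
∈-∪ˢᵗʳ⁺ˡ (true ∷ σ) (c ∷ ρ) {zero}   _  = refl
∈-∪ˢᵗʳ⁺ˡ (b ∷ σ)    (c ∷ ρ) {suc x}  x∈ = ∈-∪ˢᵗʳ⁺ˡ σ ρ x∈

∉-beyond : ∀ σ {x} → length σ ≤ x → ¬ F σ x
∉-beyond (b ∷ σ) {suc x} (s≤s |σ|≤x) x∈ = ∉-beyond σ |σ|≤x x∈

≼⇒⊆ : ∀ {σ τ} → σ ≼ τ → fs σ ⊆ˢ fs τ
≼⇒⊆ (∷≼ σ≼τ) zero    x∈ = x∈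
≼⇒⊆ (∷≼ σ≼τ) (suc x) x∈ = ≼⇒⊆ σ≼τ x x∈

≼-refl : ∀ σ → σ ≼ σ
≼-refl []      = []≼
≼-refl (b ∷ σ) = ∷≼ (≼-refl σ)

≼-trans : ∀ {σ τ υ} → σ ≼ τ → τ ≼ υ → σ ≼ υ
≼-trans []≼      _        = []≼
≼-trans (∷≼ σ≼τ) (∷≼ τ≼υ) = ∷≼ (≼-trans σ≼τ τ≼υ)

≼-∪ˢᵗʳ : ∀ σ ρ → (∀ x → F ρ x → length σ < x) → σ ≼ (σ ∪ˢᵗʳ ρ)
≼-∪ˢᵗʳ []      ρ           _      = []≼
≼-∪ˢᵗʳ (b ∷ σ) []          _      = ≼-refl (b ∷ σ)
≼-∪ˢᵗʳ (b ∷ σ) (true ∷ ρ)  beyond with () ← beyond zero refl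
≼-∪ˢᵗʳ (b ∷ σ) (false ∷ ρ) beyond =
  subst (λ c → (b ∷ σ) ≼ (c ∷ (σ ∪ˢᵗʳ ρ))) (sym (∨-identityʳ b))
    (∷≼ (≼-∪ˢᵗʳ σ ρ (λ x x∈ → ≤-pred (beyond (suc x) x∈))))

infixl 25 _∖_

_∖_ : Str → Str → Str
τ       ∖ []      = τ
[]      ∖ (b ∷ σ) = []
(c ∷ τ) ∖ (b ∷ σ) = false ∷ (τ ∖ σ)

≼⇒∪∖≡ : ∀ {σ τ} → σ ≼ τ → σ ∪ˢᵗʳ (τ ∖ σ) ≡ τ
≼⇒∪∖≡ []≼          = refl
≼⇒∪∖≡ (∷≼ {b} σ≼τ) = cong₂ _∷_ (∨-identityʳ b) (≼⇒∪∖≡ σ≼τ)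

∈-∖ : ∀ τ σ {x} → F (τ ∖ σ) x → F τ x × length σ ≤ x
∈-∖ τ       []      x∈ = x∈ , z≤n
∈-∖ (c ∷ τ) (b ∷ σ) {suc x} x∈ with ∈-∖ τ σ x∈
... | x∈τ , |σ|≤x = x∈τ , s≤s |σ|≤x

extension-split : ∀ {σ τ U} → σ ≼ τ → DiffSub τ σ U →
  Σ Str λ ρ → ρ ⊑ U × σ ∪ˢᵗʳ ρ ≡ τ
extension-split {σ} {τ} σ≼τ τ-σ⊆U = τ ∖ σ , ∖⊑U , ≼⇒∪∖≡ σ≼τ
  where
  ∖⊑U : τ ∖ σ ⊑ _
  ∖⊑U x x∈ with ∈-∖ τ σ x∈
  ... | x∈τ , |σ|≤x = τ-σ⊆U x x∈τ (∉-beyond σ |σ|≤x)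

DiffSub-mono : ∀ {τ σ U V} → U ⊆ˢ V → DiffSub τ σ U → DiffSub τ σ V
DiffSub-mono U⊆V τ-σ⊆U x x∈τ x∉σ = U⊆V x (τ-σ⊆U x x∈τ x∉σ)

DiffSub-∪ˢᵗʳ : ∀ {τ σ U} ρ → DiffSub τ σ U → ρ ⊑ U → DiffSub (τ ∪ˢᵗʳ ρ) σ U
DiffSub-∪ˢᵗʳ {τ} ρ τ-σ⊆U ρ⊑U x x∈ x∉σ with ∈-∪ˢᵗʳ⁻ τ ρ x∈
... | inj₁ x∈τ = τ-σ⊆U x x∈τ x∉σ
... | inj₂ x∈ρ = ρ⊑U x x∈ρ

∀<-cong : ∀ {b} {P Q : ℕ → Set} → (∀ x → x < b → P x ⇔ Q x) →
  (∀ x → x < b → P x) ⇔ (∀ x → x < b → Q x)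
∀<-cong P⇔Q = mk⇔ (λ h x x<b → to (P⇔Q x x<b) (h x x<b))
                  (λ h x x<b → from (P⇔Q x x<b) (h x x<b))

∃<-cong : ∀ {b} {P Q : ℕ → Set} → (∀ x → x < b → P x ⇔ Q x) →
  (∃ λ x → x < b × P x) ⇔ (∃ λ x → x < b × Q x)
∃<-cong P⇔Q = mk⇔ (λ { (x , x<b , px) → x , x<b , to (P⇔Q x x<b) px })
                  (λ { (x , x<b , qx) → x , x<b , from (P⇔Q x x<b) qx })

weakenᵗ : ∀ {k} → Term k → Term (suc k)
weakenᵗ (var i)  = var (fsuc i)
weakenᵗ zeroᵗ    = zeroᵗ
weakenᵗ (sucᵗ t) = sucᵗ (weakenᵗ t)
weakenᵗ (t +ᵗ u) = weakenᵗ t +ᵗ weakenᵗ u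
weakenᵗ (t *ᵗ u) = weakenᵗ t *ᵗ weakenᵗ u

⟦weakenᵗ⟧ : ∀ {k} (t : Term k) x ρ → ⟦ weakenᵗ t ⟧ᵗ (x ∷ ρ) ≡ ⟦ t ⟧ᵗ ρ
⟦weakenᵗ⟧ (var i)  x ρ = refl
⟦weakenᵗ⟧ zeroᵗ    x ρ = refl
⟦weakenᵗ⟧ (sucᵗ t) x ρ = cong suc (⟦weakenᵗ⟧ t x ρ)
⟦weakenᵗ⟧ (t +ᵗ u) x ρ = cong₂ _+_ (⟦weakenᵗ⟧ t x ρ) (⟦weakenᵗ⟧ u x ρ)
⟦weakenᵗ⟧ (t *ᵗ u) x ρ = cong₂ _*_ (⟦weakenᵗ⟧ t x ρ) (⟦weakenᵗ⟧ u x ρ)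

Sub : ℕ → ℕ → Set
Sub k j = Fin k → Term j

subᵗ : ∀ {k j} → Sub k j → Term k → Term j
subᵗ s (var i)  = s i
subᵗ s zeroᵗ    = zeroᵗ
subᵗ s (sucᵗ t) = sucᵗ (subᵗ s t)
subᵗ s (t +ᵗ u) = subᵗ s t +ᵗ subᵗ s u
subᵗ s (t *ᵗ u) = subᵗ s t *ᵗ subᵗ s u

liftSub : ∀ {k j} → Sub k j → Sub (suc k) (suc j)
liftSub s fzero    = var fzero
liftSub s (fsuc i) = weakenᵗ (s i)

sub : ∀ {k j} → Sub k j → Δ₀ k → Δ₀ j
sub s (t ≐ u)  = subᵗ s t ≐ subᵗ s u
sub s (t ≺ u)  = subᵗ s t ≺ subᵗ s u
sub s (t ∈G)   = subᵗ s t ∈G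
sub s (¬ᶠ φ)   = ¬ᶠ sub s φ
sub s (φ ∧ᶠ ψ) = sub s φ ∧ᶠ sub s ψ
sub s (φ ∨ᶠ ψ) = sub s φ ∨ᶠ sub s ψ
sub s (φ ⇒ᶠ ψ) = sub s φ ⇒ᶠ sub s ψ
sub s (∀< t φ) = ∀< (subᵗ s t) (sub (liftSub s) φ)
sub s (∃< t φ) = ∃< (subᵗ s t) (sub (liftSub s) φ)

_⟦_⟧ˢ≡_ : ∀ {k j} → Sub k j → Vec ℕ j → Vec ℕ k → Set
s ⟦ ρ ⟧ˢ≡ ρ′ = ∀ i → lookup ρ′ i ≡ ⟦ s i ⟧ᵗ ρ

⟦subᵗ⟧ : ∀ {k j} {s : Sub k j} {ρ ρ′} → s ⟦ ρ ⟧ˢ≡ ρ′ → (t : Term k) →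
  ⟦ t ⟧ᵗ ρ′ ≡ ⟦ subᵗ s t ⟧ᵗ ρ
⟦subᵗ⟧ s≡ (var i)  = s≡ i
⟦subᵗ⟧ s≡ zeroᵗ    = refl
⟦subᵗ⟧ s≡ (sucᵗ t) = cong suc (⟦subᵗ⟧ s≡ t)
⟦subᵗ⟧ s≡ (t +ᵗ u) = cong₂ _+_ (⟦subᵗ⟧ s≡ t) (⟦subᵗ⟧ s≡ u)
⟦subᵗ⟧ s≡ (t *ᵗ u) = cong₂ _*_ (⟦subᵗ⟧ s≡ t) (⟦subᵗ⟧ s≡ u)

⟦liftSub⟧ : ∀ {k j} {s : Sub k j} {ρ ρ′} → s ⟦ ρ ⟧ˢ≡ ρ′ →
  ∀ x → liftSub s ⟦ x ∷ ρ ⟧ˢ≡ (x ∷ ρ′)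
⟦liftSub⟧ s≡ x fzero = refl
⟦liftSub⟧ {s = s} {ρ} s≡ x (fsuc i) = trans (s≡ i) (sym (⟦weakenᵗ⟧ (s i) x ρ))

Sat-sub : ∀ {k j} (G : ℕ → Set) {s : Sub k j} {ρ ρ′} → s ⟦ ρ ⟧ˢ≡ ρ′ → (φ : Δ₀ k) →
  Sat G (sub s φ) ρ ⇔ Sat G φ ρ′
Sat-sub G {s} {ρ} {ρ′} s≡ (t ≐ u)
  rewrite ⟦subᵗ⟧ {s = s} {ρ} {ρ′} s≡ t | ⟦subᵗ⟧ {s = s} {ρ} {ρ′} s≡ u = ⇔-refl
Sat-sub G {s} {ρ} {ρ′} s≡ (t ≺ u)
  rewrite ⟦subᵗ⟧ {s = s} {ρ} {ρ′} s≡ t | ⟦subᵗ⟧ {s = s} {ρ} {ρ′} s≡ u = ⇔-refl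
Sat-sub G {s} {ρ} {ρ′} s≡ (t ∈G) rewrite ⟦subᵗ⟧ {s = s} {ρ} {ρ′} s≡ t = ⇔-refl
Sat-sub G s≡ (¬ᶠ φ)   = ¬-cong-⇔ (Sat-sub G s≡ φ)
Sat-sub G s≡ (φ ∧ᶠ ψ) = Sat-sub G s≡ φ ×-⇔ Sat-sub G s≡ ψ
Sat-sub G s≡ (φ ∨ᶠ ψ) = Sat-sub G s≡ φ ⊎-⇔ Sat-sub G s≡ ψ
Sat-sub G s≡ (φ ⇒ᶠ ψ) = →-cong-⇔ (Sat-sub G s≡ φ) (Sat-sub G s≡ ψ)
Sat-sub G {s} {ρ} {ρ′} s≡ (∀< t φ) rewrite ⟦subᵗ⟧ {s = s} {ρ} {ρ′} s≡ t =
  ∀<-cong (λ x _ → Sat-sub G (⟦liftSub⟧ s≡ x) φ)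
Sat-sub G {s} {ρ} {ρ′} s≡ (∃< t φ) rewrite ⟦subᵗ⟧ {s = s} {ρ} {ρ′} s≡ t =
  ∃<-cong (λ x _ → Sat-sub G (⟦liftSub⟧ s≡ x) φ)

numeral : ∀ {k} → ℕ → Term k
numeral zero    = zeroᵗ
numeral (suc n) = sucᵗ (numeral n)

⟦numeral⟧ : ∀ {k} n (ρ : Vec ℕ k) → ⟦ numeral n ⟧ᵗ ρ ≡ n
⟦numeral⟧ zero    ρ = refl
⟦numeral⟧ (suc n) ρ = cong suc (⟦numeral⟧ n ρ)

fixFirst : ℕ → Sub 2 2
fixFirst n fzero        = numeral n
fixFirst n (fsuc fzero) = var fzero

-- ¬Φ(G, n, m) as a formula in m (variable 0); variable 1 is a dummy.
negAt : ℕ → Δ₀ 2 → Δ₀ 2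
negAt n φ = ¬ᶠ sub (fixFirst n) φ

Sat-negAt : ∀ G n φ m k → Sat G (negAt n φ) (m ∷ k ∷ []) ⇔ (¬ Φ⟨ φ , G , n ⟩ m)
Sat-negAt G n φ m k = ¬-cong-⇔ (Sat-sub G {fixFirst n} evaluates φ)
  where
  evaluates : fixFirst n ⟦ m ∷ k ∷ [] ⟧ˢ≡ (n ∷ m ∷ [])
  evaluates fzero        = sym (⟦numeral⟧ n _)
  evaluates (fsuc fzero) = refl

maxBelow : ℕ → (ℕ → ℕ) → ℕ
maxBelow zero    f = zero
maxBelow (suc n) f = f n ⊔ maxBelow n f

≤-maxBelow : ∀ {n x} (f : ℕ → ℕ) → x < n → f x ≤ maxBelow n f
≤-maxBelow {suc n} f x<1+n with m<1+n⇒m<n∨m≡n x<1+n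
... | inj₁ x<n  = ≤-trans (≤-maxBelow f x<n) (m≤n⊔m (f n) (maxBelow n f))
... | inj₂ refl = m≤m⊔n (f n) (maxBelow n f)

-- Every query "t ∈ G" made while evaluating φ in ρ is below bound φ ρ.
bound : ∀ {k} → Δ₀ k → Vec ℕ k → ℕ
bound (t ≐ u)  ρ = zero
bound (t ≺ u)  ρ = zero
bound (t ∈G)   ρ = suc (⟦ t ⟧ᵗ ρ)
bound (¬ᶠ φ)   ρ = bound φ ρ
bound (φ ∧ᶠ ψ) ρ = bound φ ρ ⊔ bound ψ ρ
bound (φ ∨ᶠ ψ) ρ = bound φ ρ ⊔ bound ψ ρ
bound (φ ⇒ᶠ ψ) ρ = bound φ ρ ⊔ bound ψ ρ
bound (∀< t φ) ρ = maxBelow (⟦ t ⟧ᵗ ρ) (λ x → bound φ (x ∷ ρ))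
bound (∃< t φ) ρ = maxBelow (⟦ t ⟧ᵗ ρ) (λ x → bound φ (x ∷ ρ))

<-suc-extend : ∀ {B} {P Q : ℕ → Set} → (∀ x → x < B → P x → Q x) → (P B → Q B) →
  ∀ x → x < suc B → P x → Q x
<-suc-extend {B} P⇒Q PB⇒QB x x<1+B with m<1+n⇒m<n∨m≡n x<1+B
... | inj₁ x<B  = P⇒Q x x<B
... | inj₂ refl = PB⇒QB

AgreeBelow : ℕ → (ℕ → Set) → (ℕ → Set) → Set
AgreeBelow B G G′ = ∀ x → x < B → G x ⇔ G′ x

Sat-cong-below : ∀ {k B G G′} → AgreeBelow B G G′ → (φ : Δ₀ k) (ρ : Vec ℕ k) →
  bound φ ρ ≤ B → Sat G φ ρ ⇔ Sat G′ φ ρ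
Sat-cong-below agree (t ≐ u)  ρ _ = ⇔-refl
Sat-cong-below agree (t ≺ u)  ρ _ = ⇔-refl
Sat-cong-below agree (t ∈G)   ρ b≤B = agree _ b≤B
Sat-cong-below agree (¬ᶠ φ)   ρ b≤B = ¬-cong-⇔ (Sat-cong-below agree φ ρ b≤B)
Sat-cong-below agree (φ ∧ᶠ ψ) ρ b≤B =
  Sat-cong-below agree φ ρ (m⊔n≤o⇒m≤o _ _ b≤B) ×-⇔ Sat-cong-below agree ψ ρ (m⊔n≤o⇒n≤o _ _ b≤B)
Sat-cong-below agree (φ ∨ᶠ ψ) ρ b≤B =
  Sat-cong-below agree φ ρ (m⊔n≤o⇒m≤o _ _ b≤B) ⊎-⇔ Sat-cong-below agree ψ ρ (m⊔n≤o⇒n≤o _ _ b≤B)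
Sat-cong-below agree (φ ⇒ᶠ ψ) ρ b≤B =
  →-cong-⇔ (Sat-cong-below agree φ ρ (m⊔n≤o⇒m≤o _ _ b≤B))
           (Sat-cong-below agree ψ ρ (m⊔n≤o⇒n≤o _ _ b≤B))
Sat-cong-below agree (∀< t φ) ρ b≤B = ∀<-cong λ x x<t →
  Sat-cong-below agree φ (x ∷ ρ) (≤-trans (≤-maxBelow (λ y → bound φ (y ∷ ρ)) x<t) b≤B)
Sat-cong-below agree (∃< t φ) ρ b≤B = ∃<-cong λ x x<t →
  Sat-cong-below agree φ (x ∷ ρ) (≤-trans (≤-maxBelow (λ y → bound φ (y ∷ ρ)) x<t) b≤B)

atLeast : ℕ → Subset
atLeast B x = B ≤ᵇ x

∈-atLeast⁻ : ∀ {B x} → x ∈ˢ atLeast B → B ≤ x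
∈-atLeast⁻ {B} {x} x∈ = ≤ᵇ⇒≤ B x (from T-≡ x∈)

∪ˢᵗʳ-agrees-below : ∀ {B} σ ρ → ρ ⊑ atLeast B → AgreeBelow B (F (σ ∪ˢᵗʳ ρ)) (F σ)
∪ˢᵗʳ-agrees-below σ ρ ρ⊑ x x<B = mk⇔ fromUnion (∈-∪ˢᵗʳ⁺ˡ σ ρ)
  where
  fromUnion : F (σ ∪ˢᵗʳ ρ) x → F σ x
  fromUnion x∈ with ∈-∪ˢᵗʳ⁻ σ ρ x∈
  ... | inj₁ x∈σ = x∈σ
  ... | inj₂ x∈ρ = ⊥-elim (<⇒≱ x<B (∈-atLeast⁻ (ρ⊑ x x∈ρ)))

aboveOrBelow : ℕ → Fin 2 → Subset
aboveOrBelow B fzero        = atLeast B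
aboveOrBelow B (fsuc fzero) = λ x → x <ᵇ B

aboveOrBelow-covers : ∀ B x → ∃ λ j → x ∈ˢ aboveOrBelow B j
aboveOrBelow-covers B x with B ≤? x
... | yes B≤x = fzero , to T-≡ (≤⇒≤ᵇ B≤x)
... | no  B≰x = fsuc fzero , to T-≡ (<⇒<ᵇ (≰⇒> B≰x))

-- {x ≥ B} and {x < B} form a 2-cover of ω, and the finite half is not in the class.
atLeast∈⋂ : ∀ {𝒰 p} → InQ₁ 𝒰 p → ∀ B → ⋂𝒰 𝒰 (C p) (atLeast B)
atLeast∈⋂ (_ , _ , (_ , large) , onlyInfinite , _) B
  with large 2 (aboveOrBelow B) (aboveOrBelow-covers B)
... | fzero , ≥B∈⋂ = ≥B∈⋂
... | fsuc fzero , <B∈⋂ with onlyInfinite _ <B∈⋂ B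
...   | x , B<x , x<B = ⊥-elim (<-asym B<x (<ᵇ⇒< x B (from T-≡ x<B)))

forces∃∀-extension : ∀ {p φ σ n} → (∀ τ → τ ⊑ X p → ∀ m → Φˢ φ (str p ∪ˢᵗʳ τ) n m) →
  str p ≼ σ → DiffSub σ (str p) (X p) → ∀ m → Φˢ φ σ n m
forces∃∀-extension p⊩ p≼σ σ-p⊆X m with extension-split p≼σ σ-p⊆X
... | τ , τ⊑X , refl = p⊩ τ τ⊑X m

forces∀∃-extension : ∀ {ζ p φ σ} → Forces∀∃ ζ p φ →
  str p ≼ σ → DiffSub σ (str p) (U p) → ∀ n → ζ φ σ n ∈ˢ C p
forces∀∃-extension p⊩ p≼σ σ-p⊆U n with extension-split p≼σ σ-p⊆U
... | ρ , ρ⊑U , refl = p⊩ ρ ρ⊑U n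

RefutingExtension : Δ₀ 2 → Str → ℕ → Subset → Set
RefutingExtension φ σ n X =
  Σ Str λ ρ → ρ ⊑ X × (∀ x → F ρ x → length σ < x) × ∃ λ m → ¬ Φˢ φ (σ ∪ˢᵗʳ ρ) n m

module _ {𝒰 : ℕ → Class} {ζ : Δ₀ 2 → Str → ℕ → ℕ} (isζ : IsZeta 𝒰 ζ) where

  refuting-extension : ∀ φ σ n X → 𝒰 (ζ φ σ n) X → RefutingExtension φ σ n X
  refuting-extension φ σ n X = proj₁ (isζ φ σ n X)

  forces∀∃-refuting-extension : ∀ {φ p r} → InQ₁ 𝒰 r → r ≤Q p → Forces∀∃ ζ p φ →
    ∀ n → RefutingExtension φ (str r) n (U r)
  forces∀∃-refuting-extension {φ} {p} {r} (_ , _ , _ , _ , Ur∈⋂) (p≼r , _ , _ , Cp⊆Cr , r-p⊆U) p⊩ n =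
    refuting-extension φ (str r) n (U r)
      (Ur∈⋂ _ (Cp⊆Cr _ (forces∀∃-extension {ζ} {p} {φ} p⊩ p≼r r-p⊆U n)))

  forces∀∃-negAt⇒¬¬Φ : ∀ {φ n q σ} → InQ₁ 𝒰 q → Forces∀∃ ζ q (negAt n φ) →
    str q ≼ σ → DiffSub σ (str q) (U q) → ∀ m → ¬ ¬ Φˢ φ σ n m
  forces∀∃-negAt⇒¬¬Φ {φ} {n} {q} {σ} q∈ℚ₁ q⊩ q≼σ σ-q⊆U m ¬Φσ
    with refuting-extension (negAt n φ) σ m (atLeast B)
           (atLeast∈⋂ {𝒰} {q} q∈ℚ₁ B _ (forces∀∃-extension {ζ} {q} {negAt n φ} q⊩ q≼σ σ-q⊆U m))
    where
    B : ℕ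
    B = bound φ (n ∷ m ∷ [])
  ... | ρ , ρ⊑≥B , _ , k , ¬¬Φσρ =
    ¬¬Φσρ (from (Sat-negAt _ n φ m k) λ Φσρ →
      ¬Φσ (to (Sat-cong-below (∪ˢᵗʳ-agrees-below σ ρ ρ⊑≥B) φ _ ≤-refl) Φσρ))

module _ (lem : ∀ {ℓ} → ExcludedMiddle ℓ) (𝒰 : ℕ → Class) (ℱ : Cond → Set)
         (filter : IsFilter 𝒰 ℱ) where

  private
    ℱ⊆ℚ₁ : ∀ p → ℱ p → InQ₁ 𝒰 p
    ℱ⊆ℚ₁ = proj₁ filter

    directed : ∀ p q → ℱ p → ℱ q → ∃ λ r → ℱ r × r ≤Q p × r ≤Q q
    directed = proj₂ (proj₂ (proj₂ filter))

  Gℱ-captured-below : ∀ B → ∃ λ r → ℱ r × (∀ x → x < B → Gℱ ℱ x → F (str r) x)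
  Gℱ-captured-below zero with proj₁ (proj₂ filter)
  ... | r , r∈ℱ = r , r∈ℱ , λ _ ()
  Gℱ-captured-below (suc B) with Gℱ-captured-below B | lem {P = Gℱ ℱ B}
  ... | r , r∈ℱ , captured | no B∉G =
    r , r∈ℱ , <-suc-extend captured (λ B∈G → ⊥-elim (B∉G B∈G))
  ... | r , r∈ℱ , captured | yes (q , q∈ℱ , B∈q) with directed r q r∈ℱ q∈ℱ
  ...   | s , s∈ℱ , s≤r , s≤q = s , s∈ℱ ,
    <-suc-extend (λ x x<B x∈G → ≼⇒⊆ (proj₁ s≤r) x (captured x x<B x∈G))
                 (λ _ → ≼⇒⊆ (proj₁ s≤q) B B∈q)

  approximation : ∀ p → ℱ p → ∀ B →
    ∃ λ s → ℱ s × s ≤Q p × AgreeBelow B (Gℱ ℱ) (F (str s))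
  approximation p p∈ℱ B with Gℱ-captured-below B
  ... | r , r∈ℱ , captured with directed p r p∈ℱ r∈ℱ
  ...   | s , s∈ℱ , s≤p , s≤r = s , s∈ℱ , s≤p , λ x x<B →
    mk⇔ (λ x∈G → ≼⇒⊆ (proj₁ s≤r) x (captured x x<B x∈G)) (λ x∈s → s , s∈ℱ , x∈s)

  forced∃∀-holds : ∀ φ p → ℱ p → Forces∃∀ p φ → ∃ λ n → ∀ m → Φ⟨ φ , Gℱ ℱ , n ⟩ m
  forced∃∀-holds φ p p∈ℱ (n , p⊩) = n , holds
    where
    U⊆X : U p ⊆ˢ X p
    U⊆X = proj₁ (proj₂ (ℱ⊆ℚ₁ p p∈ℱ))

    holds : ∀ m → Φ⟨ φ , Gℱ ℱ , n ⟩ m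
    holds m with approximation p p∈ℱ (bound φ (n ∷ m ∷ []))
    ... | s , _ , (p≼s , _ , _ , _ , s-p⊆U) , agree =
      from (Sat-cong-below agree φ _ ≤-refl)
        (forces∃∀-extension {p} {φ} {str s} {n} p⊩ p≼s (DiffSub-mono {str s} {str p} U⊆X s-p⊆U) m)

  module _ {ζ : Δ₀ 2 → Str → ℕ → ℕ} (isζ : IsZeta 𝒰 ζ) where

    forcings-incompatible : ∀ {φ n p q} → ℱ p → ℱ q →
      Forces∀∃ ζ p φ → Forces∀∃ ζ q (negAt n φ) → ⊥
    forcings-incompatible {φ} {n} {p} {q} p∈ℱ q∈ℱ p⊩ q⊩ with directed p q p∈ℱ q∈ℱ
    ... | r , r∈ℱ , r≤p , (q≼r , _ , Ur⊆Uq , _ , r-q⊆Uq)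
      with forces∀∃-refuting-extension isζ (ℱ⊆ℚ₁ r r∈ℱ) r≤p p⊩ n
    ... | ρ , ρ⊑Ur , ρ-beyond , m , ¬Φ =
      forces∀∃-negAt⇒¬¬Φ isζ {φ} {n} {q} {str r ∪ˢᵗʳ ρ} (ℱ⊆ℚ₁ q q∈ℱ) q⊩
        (≼-trans q≼r (≼-∪ˢᵗʳ (str r) ρ ρ-beyond))
        (DiffSub-∪ˢᵗʳ {str r} {str q} {U q} ρ r-q⊆Uq (λ x x∈ρ → Ur⊆Uq x (ρ⊑Ur x x∈ρ)))
        m ¬Φ

    forced∀∃-holds : Is2Generic ζ ℱ → ∀ φ p → ℱ p → Forces∀∃ ζ p φ →
      ∀ n → ∃ λ m → ¬ Φ⟨ φ , Gℱ ℱ , n ⟩ m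
    forced∀∃-holds generic φ p p∈ℱ p⊩ n with generic (negAt n φ)
    ... | q , q∈ℱ , inj₂ q⊩ = ⊥-elim (forcings-incompatible p∈ℱ q∈ℱ p⊩ q⊩)
    ... | q , q∈ℱ , inj₁ q⊩ with forced∃∀-holds (negAt n φ) q q∈ℱ q⊩
    ...   | m , ¬Φ = m , to (Sat-negAt (Gℱ ℱ) n φ m 0) (¬Φ 0)

lemma2p29 : (lem : ∀ {ℓ} → ExcludedMiddle ℓ)
    (𝒰 : ℕ → Class) → IsUpwardEnumeration 𝒰 →
    (ζ : Δ₀ 2 → Str → ℕ → ℕ) → IsZeta 𝒰 ζ →
    (ℱ : Cond → Set) → IsFilter 𝒰 ℱ → Is2Generic ζ ℱ →
    (φ : Δ₀ 2) (p : Cond) → ℱ p →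
    (Forces∃∀ p φ → ∃ λ n → ∀ m → Φ⟨ φ , Gℱ ℱ , n ⟩ m) ×
    (Forces∀∃ ζ p φ → ∀ n → ∃ λ m → ¬ Φ⟨ φ , Gℱ ℱ , n ⟩ m)
lemma2p29 lem 𝒰 _ ζ isζ ℱ filter generic φ p p∈ℱ =
  forced∃∀-holds lem 𝒰 ℱ filter φ p p∈ℱ ,
  forced∀∃-holds lem 𝒰 ℱ filter isζ generic φ p p∈ℱ
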